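{- Let $G$ be a finite graph (loops allowed, no multiple edges) on vertex set $\{v_1,\dots,v_n\}$, and consider the synchronous dynamics described in the context, in which $v_1$ has an arbitrary update rule and every $v_i$ with $i\ge 2$ has a threshold rule with threshold $r_i$. Then there exists $T$ such that for every $t\ge T$ and every $i\in\{2,\dots,n\}$: if $v_i\in U^*_{t-1}\triangle U^*_{t+1}$, then $v_i\in N_1$ and $|N_i\cap U^*_t|=r_i-1$.
   Context: For each $i$, $N_i$ denotes the neighbourhood of $v_i$ (including $v_i$ itself iff there is a loop at $v_i$). Each vertex holds an opinion in $\{+1,-1\}$; $U_t$ is the set of vertices with opinion $+1$ at time $t$ ($t=0,1,2,\dots$), with $U_0$ arbitrary. All vertices update simultaneously: for each $i$ there is a family $\mathcal S_i$ of subsets of $N_i$ such that $v_i\in U_{t+1}$ iff $N_i\cap U_t\in\mathcal S_i$. Vertex $v_i$ has a threshold rule with (integer) threshold $r_i$ if $\mathcal S_i=\{A\subseteq N_i:|A|\ge r_i\}$. Write $U^*_t=U_t\setminus\{v_1\}$, and $\triangle$ denotes symmetric difference. -}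

module Defs where

open import Data.Nat using (ℕ; zero; suc)
open import Data.Integer using (ℤ; +_; _≤?_)
open import Data.Fin using (Fin; zero; suc)
open import Data.Fin.Subset using (Subset; _∩_; ∁; ⁅_⁆; ∣_∣; _∈_; _∉_)
open import Data.Bool using (Bool)
open import Data.Vec using (tabulate)
open import Data.Product using (_×_)
open import Data.Sum using (_⊎_)
open import Relation.Nullary.Decidable using (⌊_⌋)

-- A graph on vertex set Fin k (v₁ = zero) is given by its neighbourhood map
-- N : Fin k → Subset k (i ∈ N i iff there is a loop at i), required symmetric.
SymmetricNbhd : {k : ℕ} → (Fin k → Subset k) → Set
SymmetricNbhd {k} N = (i j : Fin k) → i ∈ N j → j ∈ N i

-- One synchronous step. v₁ (= zero) uses the arbitrary rule S₁ (a family of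
-- subsets, given as a Boolean predicate, applied to N₁ ∩ U); every other vertex
-- v_i uses the threshold rule with integer threshold r i.
step : {m : ℕ} → (Fin (suc m) → Subset (suc m)) → (Subset (suc m) → Bool)
     → (Fin (suc m) → ℤ) → Subset (suc m) → Subset (suc m)
step N S₁ r U = tabulate go
  where
  go : Fin _ → Bool
  go zero    = S₁ (N zero ∩ U)
  go (suc j) = ⌊ r (suc j) ≤? + ∣ N (suc j) ∩ U ∣ ⌋

traj : {m : ℕ} → (Fin (suc m) → Subset (suc m)) → (Subset (suc m) → Bool)
     → (Fin (suc m) → ℤ) → Subset (suc m) → ℕ → Subset (suc m)
traj N S₁ r U₀ zero    = U₀
traj N S₁ r U₀ (suc t) = step N S₁ r (traj N S₁ r U₀ t)

removeV1 : {m : ℕ} → Subset (suc m) → Subset (suc m)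
removeV1 U = U ∩ ∁ ⁅ zero ⁆

_∈△_,_ : {k : ℕ} → Fin k → Subset k → Subset k → Set
i ∈△ A , B = (i ∈ A × i ∉ B) ⊎ (i ∉ A × i ∈ B)

-- Goles' energy argument for threshold networks with one free vertex.
--
-- Write x_t for the indicator vector of U*_t, A for the adjacency matrix of
-- G, a_i(x) = Σ_k A_ik x_k for the number of +1-neighbours of v_i in U*, and
-- d_i = 2 r_i - 1 - [v_i ∈ N_1].  The energy of two consecutive states,
--     E_t = Σ_i d_i (x_{t+1,i} + x_{t,i}) - 2 Σ_i x_{t+1,i} a_i(x_t),
-- satisfies, because A is symmetric,
--     E_{t+1} - E_t = Σ_i (x_{t+2,i} - x_{t,i}) (d_i - 2 a_i(x_{t+1})).
-- The v₁-term vanishes (v₁ ∉ U*), and for a threshold vertex the summand is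
-- ≤ 0 whatever v₁ does; it is 0 while v_i changes only if v_i ∈ N_1 and
-- a_i(x_{t+1}) = r_i - 1 (the threshold is met exactly through v₁).
-- Hence E is non-increasing.  The dynamics on the finite set of subsets is
-- eventually periodic, so from some time on E is constant, every summand
-- vanishes, and every change of a threshold vertex is of the tight kind.
module Submission where

open import Defs
open import Data.Nat as ℕ using (ℕ; zero; suc; _^_; z≤n)
import Data.Nat.Properties as ℕP
import Data.Nat.Tactic.RingSolver as ℕS
open import Data.Integer using (ℤ; +_; _+_; _-_; _*_; -_; _≤_; _≤?_; +≤+)
import Data.Integer.Properties as ℤP
open import Data.Integer.Tactic.RingSolver using (solve-∀)
open import Data.Fin using (Fin; zero; suc; toℕ)
open import Data.Fin.Properties using (2↔Bool; pigeonhole)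
open import Data.Fin.Subset using (Subset; _∩_; ∣_∣; _∈_)
open import Data.Fin.Subset.Properties using (∩-identityʳ)
open import Data.Bool using (Bool; true; false; _∧_; not)
open import Data.Bool.Properties using (∧-zeroʳ; ∧-conicalˡ)
open import Data.Vec using (_∷_; []; lookup)
open import Data.Vec.Properties using (map-replicate; lookup∘tabulate; lookup⇒[]=; []=⇒lookup)
open import Data.Vec.Recursive using (lift↔; Fin[m^n]↔Fin[m]^n)
open import Data.Vec.Recursive.Properties using (↔Vec)
open import Data.Product using (Σ; _×_; _,_; proj₁; proj₂)
open import Data.Sum using (inj₁; inj₂)
open import Data.Empty using (⊥-elim)
open import Function using (_∘_; _↣_; Injection)
open import Function.Properties.Inverse using (↔-sym; ↔-trans; ↔⇒↣)
open import Relation.Binary.PropositionalEquality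
open import Relation.Nullary using (¬_; yes; no)
open import Relation.Nullary.Decidable using (⌊_⌋)
open import Algebra.Properties.Semiring.Sum ℤP.+-*-semiring
  using (sum; sum-cong-≗; ∑-distrib-+; ∑-comm; *-distribˡ-sum)

nonpos-+ : ∀ {x y : ℤ} → x ≤ + 0 → y ≤ + 0 → x + y ≤ + 0 × (x + y ≡ + 0 → x ≡ + 0 × y ≡ + 0)
nonpos-+ {x} {y} x≤0 y≤0 = ℤP.+-mono-≤ x≤0 y≤0 , vanish
  where
  vanish : x + y ≡ + 0 → x ≡ + 0 × y ≡ + 0
  vanish x+y≡0 = x≡0 , trans (sym (ℤP.+-identityˡ y)) (trans (cong (_+ y) (sym x≡0)) x+y≡0)
    where
    0≤x : + 0 ≤ x
    0≤x = subst₂ _≤_ x+y≡0 (ℤP.+-identityʳ x) (ℤP.+-monoʳ-≤ x y≤0)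
    x≡0 : x ≡ + 0
    x≡0 = ℤP.≤-antisym x≤0 0≤x

sum-nonpos : ∀ {n} (f : Fin n → ℤ) → (∀ i → f i ≤ + 0)
           → sum f ≤ + 0 × (sum f ≡ + 0 → ∀ i → f i ≡ + 0)
sum-nonpos {zero}  f f≤0 = +≤+ z≤n , λ _ ()
sum-nonpos {suc n} f f≤0 = proj₁ split , vanish
  where
  rest  = sum-nonpos (f ∘ suc) (f≤0 ∘ suc)
  split = nonpos-+ (f≤0 zero) (proj₁ rest)
  vanish : sum f ≡ + 0 → ∀ i → f i ≡ + 0
  vanish eq zero    = proj₁ (proj₂ split eq)
  vanish eq (suc i) = proj₂ rest (proj₂ (proj₂ split eq)) i

sum-affine : ∀ {n} (p q : Fin n → ℤ) (c : ℤ) → sum (λ i → p i + c * q i) ≡ sum p + c * sum q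
sum-affine p q c = trans (∑-distrib-+ p (λ i → c * q i)) (cong (_+_ (sum p)) (sym (*-distribˡ-sum c q)))

module Energy {n : ℕ} (A : Fin n → Fin n → ℤ) (A-sym : ∀ i k → A i k ≡ A k i) (d : Fin n → ℤ) where

  act : (Fin n → ℤ) → Fin n → ℤ
  act x i = sum λ k → A i k * x k

  form-sym : ∀ x y → sum (λ i → x i * act y i) ≡ sum (λ i → y i * act x i)
  form-sym x y = begin
      sum (λ i → x i * act y i)
    ≡⟨ sum-cong-≗ (λ i → *-distribˡ-sum (x i) (λ k → A i k * y k)) ⟩
      sum (λ i → sum λ k → x i * (A i k * y k))
    ≡⟨ ∑-comm (λ i k → x i * (A i k * y k)) ⟩
      sum (λ k → sum λ i → x i * (A i k * y k))
    ≡⟨ sum-cong-≗ (λ k → sum-cong-≗ (λ i →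
         trans (reorder (x i) (A i k) (y k)) (cong (λ a → y k * (a * x i)) (A-sym i k)))) ⟩
      sum (λ k → sum λ i → y k * (A k i * x i))
    ≡⟨ sum-cong-≗ (λ k → sym (*-distribˡ-sum (y k) (λ i → A k i * x i))) ⟩
      sum (λ k → y k * act x k)
    ∎
    where
    open ≡-Reasoning
    reorder : ∀ u a v → u * (a * v) ≡ v * (a * u)
    reorder = solve-∀

  energy : (Fin n → ℤ) → (Fin n → ℤ) → ℤ
  energy y x = sum λ i → d i * (y i + x i) + - + 2 * (y i * act x i)

  energy-step : ∀ z y x → energy z y ≡ energy y x + sum (λ i → (z i - x i) * (d i - + 2 * act y i))
  energy-step z y x = begin
      energy z y
    ≡⟨ sum-cong-≗ (λ i → regroup (d i) (z i) (y i) (x i) (act y i)) ⟩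
      sum (λ i → (linear i + - + 2 * (x i * act y i)) + Δ i)
    ≡⟨ ∑-distrib-+ _ Δ ⟩
      sum (λ i → linear i + - + 2 * (x i * act y i)) + sum Δ
    ≡⟨ cong (_+ sum Δ) swap-form ⟩
      energy y x + sum Δ
    ∎
    where
    open ≡-Reasoning
    linear Δ : Fin n → ℤ
    linear i = d i * (y i + x i)
    Δ i = (z i - x i) * (d i - + 2 * act y i)
    regroup : ∀ d z y x a → d * (z + y) + - + 2 * (z * a)
                          ≡ (d * (y + x) + - + 2 * (x * a)) + (z - x) * (d - + 2 * a)
    regroup = solve-∀
    swap-form : sum (λ i → linear i + - + 2 * (x i * act y i)) ≡ energy y x
    swap-form = begin
        sum (λ i → linear i + - + 2 * (x i * act y i))
      ≡⟨ sum-affine linear (λ i → x i * act y i) (- + 2) ⟩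
        sum linear + - + 2 * sum (λ i → x i * act y i)
      ≡⟨ cong (λ s → sum linear + - + 2 * s) (form-sym x y) ⟩
        sum linear + - + 2 * sum (λ i → y i * act x i)
      ≡⟨ sym (sum-affine linear (λ i → y i * act x i) (- + 2)) ⟩
        energy y x
      ∎

𝟙 : Bool → ℤ
𝟙 true  = + 1
𝟙 false = + 0

𝟙-mono : ∀ {c e} → (c ≡ true → e ≡ true) → 𝟙 c ≤ 𝟙 e
𝟙-mono {false} {false} _ = ℤP.≤-refl
𝟙-mono {false} {true}  _ = +≤+ z≤n
𝟙-mono {true}  {true}  _ = ℤP.≤-refl
𝟙-mono {true}  {false} c⇒e with () ← c⇒e refl

𝟙≤1 : ∀ c → 𝟙 c ≤ + 1
𝟙≤1 false = +≤+ z≤n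
𝟙≤1 true  = ℤP.≤-refl

0≤𝟙 : ∀ c → + 0 ≤ 𝟙 c
0≤𝟙 false = ℤP.≤-refl
0≤𝟙 true  = +≤+ z≤n

gaps : ∀ {f p q p′ q′ : ℤ} → f ≡ (p - q) + (p′ - q′) → p ≤ q → p′ ≤ q′
     → f ≤ + 0 × (f ≡ + 0 → p ≡ q × p′ ≡ q′)
gaps {p = p} {q} {p′} {q′} refl p≤q p′≤q′ =
  let f≤0 , vanish = nonpos-+ (ℤP.i≤j⇒i-j≤0 p≤q) (ℤP.i≤j⇒i-j≤0 p′≤q′)
  in f≤0 , λ f≡0 → let g≡0 , g′≡0 = vanish f≡0 in ℤP.i-j≡0⇒i≡j p q g≡0 , ℤP.i-j≡0⇒i≡j p′ q′ g′≡0

tight : ∀ {r a : ℤ} e → a + 𝟙 e ≡ r → a + + 1 ≡ r → e ≡ true × a ≡ r - + 1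
tight {r} {a} e ae≡r a1≡r =
  indicator-one e (trans (shift a (𝟙 e)) (trans (cong (_- a) (trans ae≡r (sym a1≡r))) (sym (shift a (+ 1)))))
  , trans (back a (+ 1)) (cong (_- + 1) a1≡r)
  where
  shift : ∀ a b → b ≡ (a + b) - a
  shift = solve-∀
  back : ∀ a b → a ≡ (a + b) - b
  back = solve-∀
  indicator-one : ∀ e → 𝟙 e ≡ + 1 → e ≡ true
  indicator-one true _ = refl

-- A threshold vertex with threshold r sees a +1-neighbours in U* and 𝟙 c from
-- v₁ (c implies e = [v ∈ N_1]); its new opinion is xn = [r ≤ a + 𝟙 c], its
-- opinion two steps earlier xo.
threshold-step : (r a : ℤ) (c e xo xn : Bool) → (c ≡ true → e ≡ true) → xn ≡ ⌊ r ≤? a + 𝟙 c ⌋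
  → let f = (𝟙 xn - 𝟙 xo) * ((+ 2 * r - + 1 - 𝟙 e) - + 2 * a)
    in f ≤ + 0 × (f ≡ + 0 → ¬ xn ≡ xo → e ≡ true × a ≡ r - + 1)
threshold-step r a c e xo _ c⇒e refl with r ≤? a + 𝟙 c | xo
... | yes _ | true  = +≤+ z≤n , λ _ xn≢xo → ⊥-elim (xn≢xo refl)
... | no _  | false = +≤+ z≤n , λ _ xn≢xo → ⊥-elim (xn≢xo refl)
... | yes r≤n | false =
  let f≤0 , tightness = gaps (rise r a (𝟙 e)) (ℤP.≤-trans r≤n (ℤP.+-monoʳ-≤ a (𝟙-mono c⇒e)))
                                             (ℤP.≤-trans r≤n (ℤP.+-monoʳ-≤ a (𝟙≤1 c)))
  in f≤0 , λ f≡0 _ → let r≡ae , r≡a1 = tightness f≡0 in tight e (sym r≡ae) (sym r≡a1)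
  where
  rise : ∀ r a E → (+ 1 - + 0) * ((+ 2 * r - + 1 - E) - + 2 * a) ≡ (r - (a + E)) + (r - (a + + 1))
  rise = solve-∀
... | no r≰n | true =
  let f≤0 , tightness = gaps (fall r a (𝟙 e)) (ℤP.≤-trans (ℤP.+-monoʳ-≤ a (𝟙≤1 e)) a1≤r) a1≤r
  in f≤0 , λ f≡0 _ → let ae≡r , a1≡r = tightness f≡0 in tight e ae≡r a1≡r
  where
  fall : ∀ r a E → (+ 0 - + 1) * ((+ 2 * r - + 1 - E) - + 2 * a) ≡ ((a + E) - r) + ((a + + 1) - r)
  fall = solve-∀
  pad : ∀ a → + 1 + (a + + 0) ≡ a + + 1
  pad = solve-∀
  a1≤r : a + + 1 ≤ r
  a1≤r = ℤP.≤-trans (subst (_≤ + 1 + (a + 𝟙 c)) (pad a) (ℤP.+-monoʳ-≤ (+ 1) (ℤP.+-monoʳ-≤ a (0≤𝟙 c))))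
                    (ℤP.i<j⇒suc[i]≤j (ℤP.≰⇒> r≰n))

Deterministic : {A : Set} → (ℕ → A) → Set
Deterministic u = ∀ s t → u s ≡ u t → u (suc s) ≡ u (suc t)

shift-equal : {A : Set} (u : ℕ → A) → Deterministic u → ∀ {s t} → u s ≡ u t → ∀ k → u (k ℕ.+ s) ≡ u (k ℕ.+ t)
shift-equal u det eq zero    = eq
shift-equal u det eq (suc k) = det _ _ (shift-equal u det eq k)

eventually-periodic : {A : Set} {n : ℕ} → A ↣ Fin n → (u : ℕ → A) → Deterministic u
  → Σ ℕ λ s → Σ ℕ λ p → ∀ t → s ℕ.≤ t → u (suc p ℕ.+ t) ≡ u t
eventually-periodic {n = n} code u det
  with i , j , i<j , same-code ← pigeonhole (ℕP.n<1+n n) (λ i → Injection.to code (u (toℕ i)))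
  with p , i+1+p≡j ← ℕP.m≤n⇒∃[o]m+o≡n i<j
  = toℕ i , p , periodic
  where
  repeat : u (suc p ℕ.+ toℕ i) ≡ u (toℕ i)
  repeat = trans (cong u (trans (ℕP.+-comm (suc p) (toℕ i)) (trans (ℕP.+-suc (toℕ i) p) i+1+p≡j)))
                 (sym (Injection.injective code same-code))
  periodic : ∀ t → toℕ i ℕ.≤ t → u (suc p ℕ.+ t) ≡ u t
  periodic t i≤t with k , i+k≡t ← ℕP.m≤n⇒∃[o]m+o≡n i≤t =
    subst (λ t → u (suc p ℕ.+ t) ≡ u t) i+k≡t
      (trans (cong u (rearrange (suc p) (toℕ i) k))
      (trans (shift-equal u det repeat k) (cong u (ℕP.+-comm k (toℕ i)))))
    where
    rearrange : ∀ q i k → q ℕ.+ (i ℕ.+ k) ≡ k ℕ.+ (q ℕ.+ i)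
    rearrange = ℕS.solve-∀

subset↣Fin : ∀ n → Subset n ↣ Fin (2 ^ n)
subset↣Fin n = ↔⇒↣ (↔-sym (↔-trans (Fin[m^n]↔Fin[m]^n 2 n) (↔-trans (lift↔ n 2↔Bool) (↔Vec n))))

nonincreasing-repeat : (e : ℕ → ℤ) → (∀ t → e (suc t) ≤ e t)
  → ∀ {t} p → e (suc p ℕ.+ t) ≡ e t → e (suc t) ≡ e t
nonincreasing-repeat e e-dec {t} p repeat =
  ℤP.≤-antisym (e-dec t) (subst (_≤ e (suc t)) (trans (cong e (ℕP.+-suc p t)) repeat) (drift p (suc t)))
  where
  drift : ∀ k t → e (k ℕ.+ t) ≤ e t
  drift zero    t = ℤP.≤-refl
  drift (suc k) t = ℤP.≤-trans (e-dec (k ℕ.+ t)) (drift k t)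

𝟙-∧ : ∀ x y → 𝟙 (x ∧ y) ≡ 𝟙 x * 𝟙 y
𝟙-∧ true  true  = refl
𝟙-∧ true  false = refl
𝟙-∧ false y     = refl

card-cons : ∀ {n} b (p : Subset n) → + ∣ b ∷ p ∣ ≡ 𝟙 b + + ∣ p ∣
card-cons true  p = refl
card-cons false p = refl

card-∩ : ∀ {n} (p q : Subset n) → + ∣ p ∩ q ∣ ≡ sum (λ k → 𝟙 (lookup p k) * 𝟙 (lookup q k))
card-∩ []      []      = refl
card-∩ (x ∷ p) (y ∷ q) = trans (card-cons (x ∧ y) (p ∩ q)) (cong₂ _+_ (𝟙-∧ x y) (card-∩ p q))

removeV1-cons : ∀ {m} x (p : Subset m) → removeV1 (x ∷ p) ≡ false ∷ p
removeV1-cons {m} x p = cong₂ _∷_ (∧-zeroʳ x) (trans (cong (p ∩_) (map-replicate not false m)) (∩-identityʳ p))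

removeV1-zero : ∀ {m} (V : Subset (suc m)) → lookup (removeV1 V) zero ≡ false
removeV1-zero (x ∷ p) = cong (λ W → lookup W zero) (removeV1-cons x p)

removeV1-suc : ∀ {m} (V : Subset (suc m)) j → lookup (removeV1 V) (suc j) ≡ lookup V (suc j)
removeV1-suc (x ∷ p) j = cong (λ W → lookup W (suc j)) (removeV1-cons x p)

card-split : ∀ {m} (p V : Subset (suc m))
           → + ∣ p ∩ V ∣ ≡ + ∣ p ∩ removeV1 V ∣ + 𝟙 (lookup p zero ∧ lookup V zero)
card-split (y ∷ p) (x ∷ V) = begin
    + ∣ (y ∷ p) ∩ (x ∷ V) ∣
  ≡⟨ card-cons (y ∧ x) (p ∩ V) ⟩
    𝟙 (y ∧ x) + + ∣ p ∩ V ∣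
  ≡⟨ ℤP.+-comm (𝟙 (y ∧ x)) (+ ∣ p ∩ V ∣) ⟩
    + ∣ p ∩ V ∣ + 𝟙 (y ∧ x)
  ≡⟨ cong (λ b → 𝟙 b + + ∣ p ∩ V ∣ + 𝟙 (y ∧ x)) (sym (∧-zeroʳ y)) ⟩
    (𝟙 (y ∧ false) + + ∣ p ∩ V ∣) + 𝟙 (y ∧ x)
  ≡⟨ cong (_+ 𝟙 (y ∧ x)) (sym (card-cons (y ∧ false) (p ∩ V))) ⟩
    + ∣ (y ∷ p) ∩ (false ∷ V) ∣ + 𝟙 (y ∧ x)
  ≡⟨ cong (λ W → + ∣ (y ∷ p) ∩ W ∣ + 𝟙 (y ∧ x)) (sym (removeV1-cons x V)) ⟩
    + ∣ (y ∷ p) ∩ removeV1 (x ∷ V) ∣ + 𝟙 (y ∧ x)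
  ∎
  where open ≡-Reasoning

∈△⇒differ : ∀ {n} {i : Fin n} {p q : Subset n} → i ∈△ p , q → ¬ lookup p i ≡ lookup q i
∈△⇒differ {i = i} {p} {q} (inj₁ (i∈p , i∉q)) same = i∉q (lookup⇒[]= i q (trans (sym same) ([]=⇒lookup i∈p)))
∈△⇒differ {i = i} {p} {q} (inj₂ (i∉p , i∈q)) same = i∉p (lookup⇒[]= i p (trans same ([]=⇒lookup i∈q)))

module Dynamics {m : ℕ} (N : Fin (suc m) → Subset (suc m)) (N-sym : SymmetricNbhd N)
                (S₁ : Subset (suc m) → Bool) (r : Fin (suc m) → ℤ) (U₀ : Subset (suc m)) where

  U : ℕ → Subset (suc m)
  U = traj N S₁ r U₀

  adjacent-sym : ∀ i k → lookup (N i) k ≡ true → lookup (N k) i ≡ true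
  adjacent-sym i k ik = []=⇒lookup (N-sym k i (lookup⇒[]= k (N i) ik))

  A : Fin (suc m) → Fin (suc m) → ℤ
  A i k = 𝟙 (lookup (N i) k)

  A-sym : ∀ i k → A i k ≡ A k i
  A-sym i k = cong 𝟙 (bool-ext (lookup (N i) k) (lookup (N k) i) (adjacent-sym i k) (adjacent-sym k i))
    where
    bool-ext : ∀ x y → (x ≡ true → y ≡ true) → (y ≡ true → x ≡ true) → x ≡ y
    bool-ext true  _     x⇒y _   = sym (x⇒y refl)
    bool-ext false true  _   y⇒x = y⇒x refl
    bool-ext false false _   _   = refl

  X : Subset (suc m) → Fin (suc m) → ℤ
  X V i = 𝟙 (lookup (removeV1 V) i)

  d : Fin (suc m) → ℤ
  d i = + 2 * r i - + 1 - 𝟙 (lookup (N zero) i)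

  open Energy A A-sym d

  E : ℕ → ℤ
  E t = energy (X (U (suc t))) (X (U t))

  change : ℕ → Fin (suc m) → ℤ
  change t i = (X (U (suc (suc t))) i - X (U t) i) * (d i - + 2 * act (X (U (suc t))) i)

  E-step : ∀ t → E (suc t) ≡ E t + sum (change t)
  E-step t = energy-step (X (U (suc (suc t)))) (X (U (suc t))) (X (U t))

  neighbours-in-U* : ∀ V i → + ∣ N i ∩ removeV1 V ∣ ≡ act (X V) i
  neighbours-in-U* V i = card-∩ (N i) (removeV1 V)

  threshold-update : ∀ V j → lookup (removeV1 (step N S₁ r V)) (suc j)
    ≡ ⌊ r (suc j) ≤? act (X V) (suc j) + 𝟙 (lookup (N (suc j)) zero ∧ lookup V zero) ⌋
  threshold-update V j = begin
      lookup (removeV1 (step N S₁ r V)) (suc j)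
    ≡⟨ removeV1-suc (step N S₁ r V) j ⟩
      lookup (step N S₁ r V) (suc j)
    ≡⟨ lookup∘tabulate (λ k → ⌊ r (suc k) ≤? + ∣ N (suc k) ∩ V ∣ ⌋) j ⟩
      ⌊ r (suc j) ≤? + ∣ N (suc j) ∩ V ∣ ⌋
    ≡⟨ cong (λ n → ⌊ r (suc j) ≤? n ⌋)
         (trans (card-split (N (suc j)) V) (cong (_+ v₁-vote) (neighbours-in-U* V (suc j)))) ⟩
      ⌊ r (suc j) ≤? act (X V) (suc j) + v₁-vote ⌋
    ∎
    where
    open ≡-Reasoning
    v₁-vote = 𝟙 (lookup (N (suc j)) zero ∧ lookup V zero)

  local-change : ∀ t j → change t (suc j) ≤ + 0
    × (change t (suc j) ≡ + 0
       → ¬ lookup (removeV1 (U (suc (suc t)))) (suc j) ≡ lookup (removeV1 (U t)) (suc j)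
       → lookup (N zero) (suc j) ≡ true × act (X (U (suc t))) (suc j) ≡ r (suc j) - + 1)
  local-change t j =
    threshold-step (r (suc j)) (act (X (U (suc t))) (suc j)) (lookup (N (suc j)) zero ∧ lookup (U (suc t)) zero)
                   (lookup (N zero) (suc j)) _ _
                   (adjacent-sym (suc j) zero ∘ ∧-conicalˡ _ _) (threshold-update (U (suc t)) j)

  -- v₁ never contributes, since it is not in U*
  change≤0 : ∀ t i → change t i ≤ + 0
  change≤0 t zero    = subst (λ c → c ≤ + 0) (sym v₁-silent) ℤP.≤-refl
    where
    vanish : ∀ {a b} → a ≡ false → b ≡ false → ∀ c → (𝟙 a - 𝟙 b) * c ≡ + 0
    vanish refl refl c = refl
    v₁-silent : change t zero ≡ + 0
    v₁-silent = vanish (removeV1-zero (U (suc (suc t)))) (removeV1-zero (U t)) _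
  change≤0 t (suc j) = proj₁ (local-change t j)

  E-nonincreasing : ∀ t → E (suc t) ≤ E t
  E-nonincreasing t = subst₂ _≤_ (sym (E-step t)) (ℤP.+-identityʳ (E t))
                             (ℤP.+-monoʳ-≤ (E t) (proj₁ (sum-nonpos (change t) (change≤0 t))))

  cycle : Σ ℕ λ s → Σ ℕ λ p → ∀ t → s ℕ.≤ t → U (suc p ℕ.+ t) ≡ U t
  cycle = eventually-periodic (subset↣Fin (suc m)) U (λ _ _ → cong (step N S₁ r))

  s : ℕ
  s = proj₁ cycle

  -- on the periodic part, the energy is constant and so every contribution vanishes
  no-change : ∀ t → s ℕ.≤ t → ∀ i → change t i ≡ + 0
  no-change t s≤t = proj₂ (sum-nonpos (change t) (change≤0 t)) net-zero
    where
    p = proj₁ (proj₂ cycle)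
    U-repeat = proj₂ (proj₂ cycle) t s≤t
    E-repeat : E (suc p ℕ.+ t) ≡ E t
    E-repeat = cong₂ (λ V W → energy (X V) (X W)) (cong (step N S₁ r) U-repeat) U-repeat
    E-stable : E t + sum (change t) ≡ E t
    E-stable = trans (sym (E-step t)) (nonincreasing-repeat E E-nonincreasing p E-repeat)
    cancel : ∀ a b → b ≡ (a + b) - a
    cancel = solve-∀
    net-zero : sum (change t) ≡ + 0
    net-zero = trans (cancel (E t) _) (ℤP.i≡j⇒i-j≡0 E-stable)

  flips-are-tight : ∀ t → s ℕ.≤ t → (j : Fin m)
    → suc j ∈△ removeV1 (U t) , removeV1 (U (suc (suc t)))
    → (suc j ∈ N zero) × (+ ∣ N (suc j) ∩ removeV1 (U (suc t)) ∣ ≡ r (suc j) - + 1)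
  flips-are-tight t s≤t j flip =
    let adjacent , just-below = proj₂ (local-change t j) (no-change t s≤t (suc j)) (∈△⇒differ flip ∘ sym)
    in lookup⇒[]= (suc j) (N zero) adjacent , trans (neighbours-in-U* (U (suc t)) (suc j)) just-below

theorem1 : (m : ℕ) (N : Fin (suc m) → Subset (suc m)) → SymmetricNbhd N
    → (S₁ : Subset (suc m) → Bool) (r : Fin (suc m) → ℤ) (U₀ : Subset (suc m))
    → Σ ℕ λ T → (t : ℕ) → T ℕ.≤ suc t → (j : Fin m)
    → suc j ∈△ removeV1 (traj N S₁ r U₀ t) , removeV1 (traj N S₁ r U₀ (suc (suc t)))
    → (suc j ∈ N zero)
    × (+ ∣ N (suc j) ∩ removeV1 (traj N S₁ r U₀ (suc t)) ∣ ≡ r (suc j) - + 1)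
theorem1 m N N-sym S₁ r U₀ = suc s , λ t s<1+t → flips-are-tight t (ℕP.≤-pred s<1+t)
  where open Dynamics N N-sym S₁ r U₀
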